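{- Let $H$ be a graph and let $S$ be a subset of its vertices. Then $H[S]\!\downarrow$ has at most as many edges as $H\!\downarrow$.
   Context: Graphs are finite, undirected, without self-loops. Two vertices are false twins if they have identical neighbourhoods; the equivalence classes of this relation are blocks. The twin-free quotient $H\!\downarrow$ is the graph with one vertex per block of $H$, two blocks adjacent iff $H$ has an edge between a vertex of one and a vertex of the other. $H[S]$ is the induced subgraph on $S$. -}

module Defs where

import Agda.Primitive
open import Data.Bool using (Bool; true; false)
open import Data.Nat using (ℕ; zero; suc; _+_)
open import Data.Fin using (Fin; zero; suc; _<_; _≤_)
open import Data.Fin.Properties using (all?; any?; _<?_; _≤?_)
open import Data.Fin.Subset using (Subset; inside; outside)
open import Data.Vec using ([]; _∷_; tabulate)
open import Data.Product using (Σ; ∃; _×_; _,_)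
open import Relation.Nullary using (¬_; Dec; yes; no; does)
open import Relation.Nullary.Decidable using (_×-dec_; _→-dec_)
open import Relation.Unary using (Pred; Decidable)
open import Relation.Binary.PropositionalEquality using (_≡_)
open import Data.Bool.Properties using () renaming (_≟_ to _≟ᴮ_)

Graph : ℕ → Set
Graph n = Fin n → Fin n → Bool

record IsSimple {n : ℕ} (G : Graph n) : Set where
  field
    symmetric   : ∀ u v → G u v ≡ G v u
    irreflexive : ∀ v → G v v ≡ false

countFin : ∀ {n} {P : Pred (Fin n) Agda.Primitive.lzero} → Decidable P → ℕ
countFin {zero}  P? = 0
countFin {suc n} P? with P? zero
... | yes _ = suc (countFin (λ i → P? (suc i)))
... | no  _ = countFin (λ i → P? (suc i))

sumFin : ∀ {n} → (Fin n → ℕ) → ℕ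
sumFin {zero}  f = 0
sumFin {suc n} f = f zero + sumFin (λ i → f (suc i))

-- Number of edges: unordered pairs {u , v} (counted once, as u < v) with u adjacent to v.
edgeCount : ∀ {n} → Graph n → ℕ
edgeCount G = sumFin (λ u → countFin (λ v → (u <? v) ×-dec (G u v ≟ᴮ true)))

size : ∀ {n} → Subset n → ℕ
size []            = 0
size (inside  ∷ p) = suc (size p)
size (outside ∷ p) = size p

elem : ∀ {n} (S : Subset n) → Fin (size S) → Fin n
elem (inside  ∷ p) zero    = zero
elem (inside  ∷ p) (suc i) = suc (elem p i)
elem (outside ∷ p) i       = suc (elem p i)

induced : ∀ {n} → Graph n → (S : Subset n) → Graph (size S)
induced G S i j = G (elem S i) (elem S j)

Twins : ∀ {n} → Graph n → Fin n → Fin n → Set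
Twins G u v = ∀ w → G u w ≡ G v w

twins? : ∀ {n} (G : Graph n) u v → Dec (Twins G u v)
twins? G u v = all? (λ w → G u w ≟ᴮ G v w)

-- Each block is represented by its least vertex.
IsRep : ∀ {n} → Graph n → Fin n → Set
IsRep G v = ∀ u → Twins G u v → v ≤ u

isRep? : ∀ {n} (G : Graph n) v → Dec (IsRep G v)
isRep? G v = all? (λ u → twins? G u v →-dec (v ≤? u))

reps : ∀ {n} → Graph n → Subset n
reps G = tabulate (λ v → does (isRep? G v))

BlockAdj : ∀ {n} → Graph n → Fin n → Fin n → Set
BlockAdj G r s = ∃ λ x → ∃ λ y → Twins G x r × Twins G y s × G x y ≡ true

blockAdj? : ∀ {n} (G : Graph n) r s → Dec (BlockAdj G r s)
blockAdj? G r s = any? (λ x → any? (λ y → twins? G x r ×-dec (twins? G y s ×-dec (G x y ≟ᴮ true))))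

quotient : ∀ {n} → (G : Graph n) → Graph (size (reps G))
quotient G i j = does (blockAdj? G (elem (reps G) i) (elem (reps G) j))

-- Two vertices of S that are twins in H are already twins in H[S], so sending each block
-- of H[S] to the block of H containing its representative is injective. In a symmetric
-- graph two blocks are adjacent exactly when their representatives are, so this map also
-- sends edges of H[S]↓ to edges of H↓: it embeds H[S]↓ into H↓ as a subgraph.

module Submission where

open import Defs
open import Data.Nat using (ℕ; _≤_)
open import Data.Fin.Subset using (Subset)

open import Level using (0ℓ)
open import Function using (_∘_; id)
open import Function.Bundles using (mk⇔)
open import Function.Definitions using (Injective)
open import Data.Bool using (true)
open import Data.Bool.Properties using () renaming (_≟_ to _≟ᴮ_)
open import Data.Nat using (zero; suc; _+_; z≤n; s≤s)
import Data.Nat.Properties as ℕ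
open import Data.Fin as Fin using (Fin; zero; suc)
open import Data.Fin.Properties using (_<?_; <-cmp; <-asym; <⇒≢; ≤-antisym; suc-injective; injective⇒≤)
open import Data.Fin.Subset using (inside; outside) renaming (_∈_ to _∈ₛ_)
open import Data.Vec using (_∷_; here; there)
open import Data.Vec.Properties using (lookup∘tabulate; lookup⇒[]=; []=⇒lookup)
open import Data.Product using (∃; _×_; _,_; proj₁; proj₂)
open import Data.Product.Properties using (,-injective)
open import Data.Sum using (_⊎_; inj₁; inj₂)
open import Data.List using (List; _++_; length; lookup; filter; tabulate; map; cartesianProduct; allFin)
open import Data.List.Properties using (filter-++; length-++; map-tabulate)
open import Data.List.Membership.Propositional using (_∈_)
open import Data.List.Membership.Propositional.Properties
  using (∈-lookup; ∈-filter⁺; ∈-filter⁻; ∈-cartesianProduct⁺; ∈-allFin)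
open import Data.List.Relation.Unary.Any using (index)
open import Data.List.Relation.Unary.Any.Properties using (lookup-index)
open import Data.List.Relation.Unary.All using () renaming (lookup to All-lookup)
open import Data.List.Relation.Unary.AllPairs using (_∷_)
open import Data.List.Relation.Unary.Unique.Propositional using (Unique)
import Data.List.Relation.Unary.Unique.Propositional.Properties as Unique
open import Relation.Nullary using (Dec; yes; no; does; contradiction)
open import Relation.Nullary.Decidable using (_×-dec_; dec-true; does-⇔)
open import Relation.Unary using (Pred; Decidable)
open import Relation.Binary.PropositionalEquality
  using (_≡_; _≢_; refl; sym; trans; cong; cong₂; subst₂; module ≡-Reasoning)
open import Relation.Binary.Definitions using (tri<; tri≈; tri>)

lookup-injective : ∀ {A : Set} {xs : List A} → Unique xs →
                   ∀ {i j} → lookup xs i ≡ lookup xs j → i ≡ j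
lookup-injective (_ ∷ _) {zero} {zero} _ = refl
lookup-injective (x∉xs ∷ _) {zero} {suc j} eq = contradiction eq (All-lookup x∉xs (∈-lookup j))
lookup-injective (x∉xs ∷ _) {suc i} {zero} eq = contradiction (sym eq) (All-lookup x∉xs (∈-lookup i))
lookup-injective (_ ∷ xs!) {suc i} {suc j} eq = cong suc (lookup-injective xs! eq)

length-≤-injection : ∀ {A B : Set} {xs : List A} {ys : List B} (f : A → B) →
  Unique xs → (∀ {x} → x ∈ xs → f x ∈ ys) →
  (∀ {x y} → x ∈ xs → y ∈ xs → f x ≡ f y → x ≡ y) →
  length xs ≤ length ys
length-≤-injection {xs = xs} {ys} f xs! f-into f-inj = injective⇒≤ {f = position} position-injective
  where
  position : Fin (length xs) → Fin (length ys)
  position i = index (f-into (∈-lookup i))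

  position-injective : Injective _≡_ _≡_ position
  position-injective {i} {j} eq = lookup-injective xs! (f-inj (∈-lookup i) (∈-lookup j) (begin
    f (lookup xs i)             ≡⟨ lookup-index (f-into (∈-lookup i)) ⟩
    lookup ys (position i)      ≡⟨ cong (lookup ys) eq ⟩
    lookup ys (position j)      ≡⟨ lookup-index (f-into (∈-lookup j)) ⟨
    f (lookup xs j)             ∎))
    where open ≡-Reasoning

countFin≡length-filter : ∀ {A : Set} {n} {P : Pred A 0ℓ} (P? : Decidable P) (g : Fin n → A) →
                         countFin (P? ∘ g) ≡ length (filter P? (tabulate g))
countFin≡length-filter {n = zero} P? g = refl
countFin≡length-filter {n = suc n} P? g with P? (g zero)
... | yes _ = cong suc (countFin≡length-filter P? (g ∘ suc))
... | no _ = countFin≡length-filter P? (g ∘ suc)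

sumFin-countFin≡length-filter : ∀ {A B : Set} {n m} {R : Pred (A × B) 0ℓ} (R? : Decidable R)
  (g : Fin n → A) (h : Fin m → B) →
  sumFin (λ u → countFin (λ v → R? (g u , h v))) ≡ length (filter R? (cartesianProduct (tabulate g) (tabulate h)))
sumFin-countFin≡length-filter {n = zero} R? g h = refl
sumFin-countFin≡length-filter {A} {B} {suc n} R? g h = begin
  countFin (λ v → R? (g zero , h v)) + sumFin (λ u → countFin (λ v → R? (g (suc u) , h v)))
    ≡⟨ cong₂ _+_ (countFin≡length-filter R? ((g zero ,_) ∘ h)) (sumFin-countFin≡length-filter R? (g ∘ suc) h) ⟩
  length (filter R? (tabulate ((g zero ,_) ∘ h))) + length (filter R? rest)
    ≡⟨ cong (λ row → length (filter R? row) + length (filter R? rest)) (map-tabulate h (g zero ,_)) ⟨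
  length (filter R? row₀) + length (filter R? rest)
    ≡⟨ length-++ (filter R? row₀) ⟨
  length (filter R? row₀ ++ filter R? rest)
    ≡⟨ cong length (filter-++ R? row₀ rest) ⟨
  length (filter R? (row₀ ++ rest))
    ∎
  where
  open ≡-Reasoning
  row₀ rest : List (A × B)
  row₀ = map (g zero ,_) (tabulate h)
  rest = cartesianProduct (tabulate (g ∘ suc)) (tabulate h)

IsEdge : ∀ {n} → Graph n → Pred (Fin n × Fin n) 0ℓ
IsEdge G (u , v) = u Fin.< v × G u v ≡ true

isEdge? : ∀ {n} (G : Graph n) → Decidable (IsEdge G)
isEdge? G (u , v) = (u <? v) ×-dec (G u v ≟ᴮ true)

edges : ∀ {n} → Graph n → List (Fin n × Fin n)
edges {n} G = filter (isEdge? G) (cartesianProduct (allFin n) (allFin n))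

edgeCount≡length-edges : ∀ {n} (G : Graph n) → edgeCount G ≡ length (edges G)
edgeCount≡length-edges G = sumFin-countFin≡length-filter (isEdge? G) id id

∈-edges⁺ : ∀ {n} {G : Graph n} {e} → IsEdge G e → e ∈ edges G
∈-edges⁺ {G = G} e-edge = ∈-filter⁺ (isEdge? G) (∈-cartesianProduct⁺ (∈-allFin _) (∈-allFin _)) e-edge

∈-edges⁻ : ∀ {n} {G : Graph n} {e} → e ∈ edges G → IsEdge G e
∈-edges⁻ {n} {G} e∈edges = proj₂ (∈-filter⁻ (isEdge? G) {xs = cartesianProduct (allFin n) (allFin n)} e∈edges)

edges-unique : ∀ {n} (G : Graph n) → Unique (edges G)
edges-unique {n} G = Unique.filter⁺ (isEdge? G) (Unique.cartesianProduct⁺ (Unique.allFin⁺ n) (Unique.allFin⁺ n))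

orient : ∀ {n} → Fin n → Fin n → Fin n × Fin n
orient a b with <-cmp a b
... | tri> _ _ _ = b , a
... | _ = a , b

orient-either : ∀ {n} (a b : Fin n) → orient a b ≡ (a , b) ⊎ orient a b ≡ (b , a)
orient-either a b with <-cmp a b
... | tri< _ _ _ = inj₁ refl
... | tri≈ _ _ _ = inj₁ refl
... | tri> _ _ _ = inj₂ refl

orient-edge : ∀ {n} {G : Graph n} → (∀ u v → G u v ≡ G v u) →
              ∀ {a b} → a ≢ b → G a b ≡ true → IsEdge G (orient a b)
orient-edge G-sym {a} {b} a≢b ab with <-cmp a b
... | tri< a<b _ _ = a<b , ab
... | tri≈ _ a≡b _ = contradiction a≡b a≢b
... | tri> _ _ b<a = b<a , trans (G-sym b a) ab

orient-≡ : ∀ {n} {a b c d : Fin n} → orient a b ≡ orient c d → (a ≡ c × b ≡ d) ⊎ (a ≡ d × b ≡ c)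
orient-≡ {a = a} {b} {c} {d} eq with orient-either a b | orient-either c d
... | inj₁ ab | inj₁ cd = inj₁ (,-injective (trans (sym ab) (trans eq cd)))
... | inj₁ ab | inj₂ dc = inj₂ (,-injective (trans (sym ab) (trans eq dc)))
... | inj₂ ba | inj₁ cd = let b≡c , a≡d = ,-injective (trans (sym ba) (trans eq cd)) in inj₂ (a≡d , b≡c)
... | inj₂ ba | inj₂ dc = let b≡d , a≡c = ,-injective (trans (sym ba) (trans eq dc)) in inj₁ (a≡c , b≡d)

edgeCount-≤-injective-homomorphism : ∀ {m n} (G : Graph m) (G' : Graph n) → (∀ u v → G' u v ≡ G' v u) →
  (φ : Fin m → Fin n) → Injective _≡_ _≡_ φ → (∀ u v → G u v ≡ true → G' (φ u) (φ v) ≡ true) →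
  edgeCount G ≤ edgeCount G'
edgeCount-≤-injective-homomorphism {m} {n} G G' G'-sym φ φ-injective φ-homomorphism = begin
  edgeCount G        ≡⟨ edgeCount≡length-edges G ⟩
  length (edges G)   ≤⟨ length-≤-injection image (edges-unique G) image-edge image-injective ⟩
  length (edges G')  ≡⟨ edgeCount≡length-edges G' ⟨
  edgeCount G'       ∎
  where
  open ℕ.≤-Reasoning

  image : Fin m × Fin m → Fin n × Fin n
  image (u , v) = orient (φ u) (φ v)

  image-edge : ∀ {e} → e ∈ edges G → image e ∈ edges G'
  image-edge {u , v} e∈G with u<v , uv ← ∈-edges⁻ e∈G =
    ∈-edges⁺ (orient-edge G'-sym (<⇒≢ u<v ∘ φ-injective) (φ-homomorphism u v uv))

  image-injective : ∀ {e e'} → e ∈ edges G → e' ∈ edges G → image e ≡ image e' → e ≡ e'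
  image-injective {u , v} {u' , v'} e∈G e'∈G eq with orient-≡ eq
  ... | inj₁ (φu≡φu' , φv≡φv') = cong₂ _,_ (φ-injective φu≡φu') (φ-injective φv≡φv')
  ... | inj₂ (φu≡φv' , φv≡φu') = contradiction v<u (<-asym (proj₁ (∈-edges⁻ e∈G)))
    where
    v<u : v Fin.< u
    v<u = subst₂ Fin._<_ (sym (φ-injective φv≡φu')) (sym (φ-injective φu≡φv')) (proj₁ (∈-edges⁻ e'∈G))

elem-∈ : ∀ {n} (S : Subset n) i → elem S i ∈ₛ S
elem-∈ (inside ∷ p) zero = here
elem-∈ (inside ∷ p) (suc i) = there (elem-∈ p i)
elem-∈ (outside ∷ p) i = there (elem-∈ p i)

elem-surjective : ∀ {n} {S : Subset n} {x} → x ∈ₛ S → ∃ λ i → elem S i ≡ x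
elem-surjective {S = inside ∷ p} here = zero , refl
elem-surjective {S = inside ∷ p} (there x∈p) with i , eq ← elem-surjective x∈p = suc i , cong suc eq
elem-surjective {S = outside ∷ p} (there x∈p) with i , eq ← elem-surjective x∈p = i , cong suc eq

elem-injective : ∀ {n} (S : Subset n) → Injective _≡_ _≡_ (elem S)
elem-injective (inside ∷ p) {zero} {zero} _ = refl
elem-injective (inside ∷ p) {suc i} {suc j} eq = cong suc (elem-injective p (suc-injective eq))
elem-injective (outside ∷ p) eq = elem-injective p (suc-injective eq)

does≡true⇒ : ∀ {A : Set} (a? : Dec A) → does a? ≡ true → A
does≡true⇒ (yes a) _ = a
does≡true⇒ (no _) ()

least : ∀ {n} {P : Pred (Fin n) 0ℓ} → Decidable P → ∀ {x} → P x → ∃ λ v → P v × (∀ {u} → P u → v Fin.≤ u)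
least {suc n} P? {zero} p0 = zero , p0 , λ _ → z≤n
least {suc n} P? {suc x} px with P? zero
... | yes p0 = zero , p0 , λ _ → z≤n
... | no ¬p0 with v , pv , v-least ← least (P? ∘ suc) px =
  suc v , pv , λ { {zero} p0 → contradiction p0 ¬p0 ; {suc u} pu → s≤s (v-least pu) }

module _ {n} {G : Graph n} where

  twins-sym : ∀ {u v} → Twins G u v → Twins G v u
  twins-sym u~v w = sym (u~v w)

  twins-trans : ∀ {u v x} → Twins G u v → Twins G v x → Twins G u x
  twins-trans u~v v~x w = trans (u~v w) (v~x w)

  twin-reps-equal : ∀ {r s} → IsRep G r → IsRep G s → Twins G r s → r ≡ s
  twin-reps-equal r-rep s-rep r~s = ≤-antisym (r-rep _ (twins-sym r~s)) (s-rep _ r~s)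

  ∈-reps⁺ : ∀ {r} → IsRep G r → r ∈ₛ reps G
  ∈-reps⁺ {r} r-rep = lookup⇒[]= r (reps G) (trans (lookup∘tabulate _ r) (dec-true (isRep? G r) r-rep))

  ∈-reps⁻ : ∀ {r} → r ∈ₛ reps G → IsRep G r
  ∈-reps⁻ {r} r∈reps = does≡true⇒ (isRep? G r) (trans (sym (lookup∘tabulate _ r)) ([]=⇒lookup r∈reps))

representative : ∀ {n} (G : Graph n) v → ∃ λ r → Twins G v r × IsRep G r
representative G v with r , v~r , r-least ← least (twins? G v) {v} (λ _ → refl) =
  r , v~r , λ u u~r → r-least (twins-trans {G = G} v~r (twins-sym {G = G} u~r))

blockOf : ∀ {n} (G : Graph n) v → ∃ λ i → Twins G v (elem (reps G) i)
blockOf G v with representative G v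
... | r , v~r , r-rep with elem-surjective (∈-reps⁺ r-rep)
... | i , refl = i , v~r

block : ∀ {n} (G : Graph n) → Fin n → Fin (size (reps G))
block G v = proj₁ (blockOf G v)

twins-block : ∀ {n} (G : Graph n) v → Twins G v (elem (reps G) (block G v))
twins-block G v = proj₂ (blockOf G v)

block-twins : ∀ {n} (G : Graph n) {u v} → block G u ≡ block G v → Twins G u v
block-twins G {u} {v} eq w = begin
  G u w                              ≡⟨ twins-block G u w ⟩
  G (elem (reps G) (block G u)) w    ≡⟨ cong (λ i → G (elem (reps G) i) w) eq ⟩
  G (elem (reps G) (block G v)) w    ≡⟨ twins-block G v w ⟨
  G v w                              ∎
  where open ≡-Reasoning

quotient-adjacent⁺ : ∀ {n} (G : Graph n) {u v} → G u v ≡ true → quotient G (block G u) (block G v) ≡ true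
quotient-adjacent⁺ G {u} {v} uv = dec-true (blockAdj? G _ _) (u , v , twins-block G u , twins-block G v , uv)

module _ {n} {G : Graph n} (G-sym : ∀ u v → G u v ≡ G v u) where

  blockAdj⇒adjacent : ∀ {r s} → BlockAdj G r s → G r s ≡ true
  blockAdj⇒adjacent {r} {s} (x , y , x~r , y~s , xy) = begin
    G r s  ≡⟨ G-sym r s ⟩
    G s r  ≡⟨ y~s r ⟨
    G y r  ≡⟨ G-sym y r ⟩
    G r y  ≡⟨ x~r y ⟨
    G x y  ≡⟨ xy ⟩
    true   ∎
    where open ≡-Reasoning

  quotient-adjacent⁻ : ∀ {i j} → quotient G i j ≡ true → G (elem (reps G) i) (elem (reps G) j) ≡ true
  quotient-adjacent⁻ ij = blockAdj⇒adjacent (does≡true⇒ (blockAdj? G _ _) ij)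

  quotient-symmetric : ∀ i j → quotient G i j ≡ quotient G j i
  quotient-symmetric i j = does-⇔ (mk⇔ swap swap) (blockAdj? G _ _) (blockAdj? G _ _)
    where
    swap : ∀ {r s} → BlockAdj G r s → BlockAdj G s r
    swap (x , y , x~r , y~s , xy) = y , x , y~s , x~r , trans (G-sym y x) xy

module _ {n} (H : Graph n) (S : Subset n) where

  blockInclusion : Fin (size (reps (induced H S))) → Fin (size (reps H))
  blockInclusion i = block H (elem S (elem (reps (induced H S)) i))

  blockInclusion-injective : Injective _≡_ _≡_ blockInclusion
  blockInclusion-injective {i} {j} eq = elem-injective (reps (induced H S))
    (twin-reps-equal (∈-reps⁻ (elem-∈ _ i)) (∈-reps⁻ (elem-∈ _ j)) (λ w → block-twins H eq (elem S w)))

  blockInclusion-homomorphism : (∀ u v → H u v ≡ H v u) →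
    ∀ i j → quotient (induced H S) i j ≡ true → quotient H (blockInclusion i) (blockInclusion j) ≡ true
  blockInclusion-homomorphism H-sym i j ij =
    quotient-adjacent⁺ H (quotient-adjacent⁻ (λ u v → H-sym (elem S u) (elem S v)) ij)

lemma7 : ∀ {n} (H : Graph n) → IsSimple H → (S : Subset n) →
    edgeCount (quotient (induced H S)) ≤ edgeCount (quotient H)
lemma7 H hs S = edgeCount-≤-injective-homomorphism (quotient (induced H S)) (quotient H)
  (quotient-symmetric H-sym) (blockInclusion H S) (blockInclusion-injective H S) (blockInclusion-homomorphism H S H-sym)
  where open IsSimple hs renaming (symmetric to H-sym)
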